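{- Let $b\geq 1$ and $k\geq 0$, and put $n=2b+k$. For $S\in\mathrm{SYT}^{+k}(2\times b)$ define the path $\beta(S)$ of length $n$ whose $j$-th step ($1\leq j\leq n$) is: an up step $U$ if $j$ is the minimum entry of a top-row cell of $S$; a down step $D$ if $j$ is the minimum entry of a bottom-row cell; an umber horizontal step if $j$ is a non-minimal entry of a top-row cell; a denim horizontal step if $j$ is a non-minimal entry of a bottom-row cell. Then $\beta$ is a bijection from $\mathrm{SYT}^{+k}(2\times b)$ to the set of paths in $\mathrm{Motz}^{\{1,2\}}(n)$ having exactly $k$ horizontal steps.
   Context: $\mathrm{SYT}^{+k}(\lambda)$ for a partition $\lambda$ of $N$ is the set of fillings of the cells of $\lambda$ (English convention) by nonempty sets of positive integers forming a set partition of $[N+k]$, such that whenever $u\neq v$ with $u$ weakly north and weakly west of $v$, $\max S(u)<\min S(v)$; $2\times b$ is the shape with two rows of $b$ cells. A bicolored Motzkin path of length $n$ is a lattice path from $(0,0)$ to $(n,0)$ with steps $U=(1,1)$, $D=(1,-1)$ and horizontal steps $(1,0)$, each horizontal step colored umber ($u$) or denim ($d$), never going below the $x$-axis. $\mathrm{Motz}^{\{1,2\}}(n)$ is the set of such paths satisfying both: (1) no umber horizontal step occurs at height zero; (2) no denim horizontal step occurs before the first down step. -}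

module Defs where

open import Data.Nat as ℕ using (ℕ; zero; suc; _+_; _*_)
open import Data.Fin as Fin using (Fin; toℕ)
open import Data.Fin.Properties using (any?; _≟_)
open import Data.Product using (Σ; ∃; _×_; _,_; proj₁; proj₂)
open import Data.Product.Properties using (≡-dec)
open import Data.Vec using (Vec; []; _∷_; tabulate)
open import Data.Empty using (⊥)
open import Data.Unit using (⊤)
open import Relation.Nullary using (Dec; yes; no; ¬_)
open import Relation.Binary.PropositionalEquality using (_≡_; _≢_)

-- Shape 2 × b.  A cell is (row , column); row 0 is the top row
-- (English convention), column 0 the leftmost column.

Cell : ℕ → Set
Cell b = Fin 2 × Fin b

row : ∀ {b} → Cell b → Fin 2
row = proj₁

col : ∀ {b} → Cell b → Fin b
col = proj₂

WeaklyNW : ∀ {b} → Cell b → Cell b → Set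
WeaklyNW u v = (row u Fin.≤ row v) × (col u Fin.≤ col v)

-- The entries are [N+k] = {1,…,2b+k}, encoded as Fin (2b+k)
-- (entry j+1 ↦ j).  A filling of the cells by sets forming a set
-- partition of [N+k] is encoded by the map f sending each entry to the
-- cell containing it; the set in cell c is S(c) = { j | f j ≡ c }.
-- Blocks are disjoint and cover [N+k] automatically; nonemptiness is a
-- condition.

Entries : ℕ → ℕ → Set
Entries b k = Fin (2 * b + k)

Filling : ℕ → ℕ → Set
Filling b k = Entries b k → Cell b

_∈S[_]_ : ∀ {b k} → Entries b k → Filling b k → Cell b → Set
j ∈S[ f ] c = f j ≡ c

record IsSYT+ (b k : ℕ) (f : Filling b k) : Set where
  field
    nonempty   : (c : Cell b) → ∃ λ j → j ∈S[ f ] c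
    increasing : (u v : Cell b) → u ≢ v → WeaklyNW u v →
                 (i j : Entries b k) → i ∈S[ f ] u → j ∈S[ f ] v →
                 i Fin.< j

SYT+ : ℕ → ℕ → Set
SYT+ b k = Σ (Filling b k) (IsSYT+ b k)

data Colour : Set where
  umber denim : Colour

data Step : Set where
  U D : Step
  H   : Colour → Step

Path : ℕ → Set
Path n = Vec Step n

MotzFrom : ∀ {n} → ℕ → Path n → Set
MotzFrom zero    []           = ⊤
MotzFrom (suc h) []           = ⊥
MotzFrom h       (U ∷ p)      = MotzFrom (suc h) p
MotzFrom zero    (D ∷ p)      = ⊥
MotzFrom (suc h) (D ∷ p)      = MotzFrom h p
MotzFrom h       (H _ ∷ p)    = MotzFrom h p

IsMotzkin : ∀ {n} → Path n → Set
IsMotzkin = MotzFrom 0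

NoUmberAtZeroFrom : ∀ {n} → ℕ → Path n → Set
NoUmberAtZeroFrom h       []            = ⊤
NoUmberAtZeroFrom h       (U ∷ p)       = NoUmberAtZeroFrom (suc h) p
NoUmberAtZeroFrom h       (D ∷ p)       = NoUmberAtZeroFrom (ℕ.pred h) p
NoUmberAtZeroFrom zero    (H umber ∷ p) = ⊥
NoUmberAtZeroFrom (suc h) (H umber ∷ p) = NoUmberAtZeroFrom (suc h) p
NoUmberAtZeroFrom h       (H denim ∷ p) = NoUmberAtZeroFrom h p

NoDenimBeforeFirstD : ∀ {n} → Path n → Set
NoDenimBeforeFirstD []            = ⊤
NoDenimBeforeFirstD (D ∷ p)       = ⊤
NoDenimBeforeFirstD (U ∷ p)       = NoDenimBeforeFirstD p
NoDenimBeforeFirstD (H umber ∷ p) = NoDenimBeforeFirstD p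
NoDenimBeforeFirstD (H denim ∷ p) = ⊥

IsMotz12 : ∀ {n} → Path n → Set
IsMotz12 p = IsMotzkin p × NoUmberAtZeroFrom 0 p × NoDenimBeforeFirstD p

horizontals : ∀ {n} → Path n → ℕ
horizontals []        = 0
horizontals (U ∷ p)   = horizontals p
horizontals (D ∷ p)   = horizontals p
horizontals (H _ ∷ p) = suc (horizontals p)

earlier? : ∀ {b k} (f : Filling b k) (j : Entries b k) →
           Dec (∃ λ i → (i Fin.< j) × (f i ≡ f j))
earlier? f j = any? (λ i → (i Fin.<? j) Relation.Nullary.×-dec ≡-dec _≟_ _≟_ (f i) (f j))

stepFor : Fin 2 → ∀ {A : Set} → Dec A → Step
stepFor Fin.zero         (no _)  = U
stepFor Fin.zero         (yes _) = H umber
stepFor (Fin.suc Fin.zero) (no _)  = D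
stepFor (Fin.suc Fin.zero) (yes _) = H denim

β : ∀ {b k} → Filling b k → Path (2 * b + k)
β f = tabulate λ j → stepFor (row (f j)) (earlier? f j)

module Submission where

-- Reading a filling entry by entry, the cells of each row are opened from left to right, so
-- the column of an entry in row r is one less than the number of minima of row r up to it.
-- Hence β f determines f, and the shape conditions become conditions on prefix counts of the
-- path (height = #U − #D): a bottom cell can only be opened, and a top cell only receive a
-- further entry, while the height is positive; a bottom cell can only receive a further
-- entry after some bottom cell was opened.  These are the prefix-count forms of the Motzkin,
-- no-umber-at-zero and no-denim-before-first-D conditions.  Conversely, a path satisfying
-- them is β of the filling that puts entry j into the row of its step and the column given
-- by that count.

open import Defs
open import Data.Nat using (ℕ; zero; suc; _+_; _*_; _≤_; _<_; z≤n; s≤s; s≤s⁻¹; z<s; pred; >-nonZero)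
open import Data.Nat.Properties
open import Data.Fin as Fin using (Fin; toℕ; fromℕ<)
open import Data.Fin.Patterns using (0F; 1F)
open import Data.Fin.Properties using (toℕ-fromℕ<; toℕ-fromℕ; toℕ-injective; toℕ<n)
open import Data.Product using (∃; _×_; _,_; proj₁; proj₂)
open import Data.Sum using (_⊎_; inj₁; inj₂)
open import Data.Vec using ([]; _∷_; lookup)
open import Data.Vec.Properties using (lookup∘tabulate; tabulate∘lookup; tabulate-cong)
open import Data.Unit using (tt)
open import Function using (_∘_; id)
open import Relation.Nullary using (Dec; yes; no; ¬_; contradiction)
open import Relation.Binary.PropositionalEquality

minStep : Fin 2 → Step
minStep 0F = U
minStep 1F = D

nonMinStep : Fin 2 → Step
nonMinStep 0F = H umber
nonMinStep 1F = H denim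

rowOf : Step → Fin 2
rowOf U         = 0F
rowOf (H umber) = 0F
rowOf D         = 1F
rowOf (H denim) = 1F

step-view : ∀ s → s ≡ minStep (rowOf s) ⊎ s ≡ nonMinStep (rowOf s)
step-view U         = inj₁ refl
step-view D         = inj₁ refl
step-view (H umber) = inj₂ refl
step-view (H denim) = inj₂ refl

rowOf-minStep : ∀ r → rowOf (minStep r) ≡ r
rowOf-minStep 0F = refl
rowOf-minStep 1F = refl

nonMinStep≢minStep : ∀ r r′ → nonMinStep r ≢ minStep r′
nonMinStep≢minStep 0F 0F ()
nonMinStep≢minStep 0F 1F ()
nonMinStep≢minStep 1F 0F ()
nonMinStep≢minStep 1F 1F ()

minStep? : ∀ r s → Dec (s ≡ minStep r)
minStep? 0F U         = yes refl
minStep? 0F D         = no λ ()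
minStep? 0F (H _)     = no λ ()
minStep? 1F U         = no λ ()
minStep? 1F D         = yes refl
minStep? 1F (H _)     = no λ ()

minStep-injective : ∀ {r r′} → minStep r ≡ minStep r′ → r ≡ r′
minStep-injective {r} {r′} eq =
  trans (sym (rowOf-minStep r)) (trans (cong rowOf eq) (rowOf-minStep r′))

nonMinStep-injective : ∀ {r r′} → nonMinStep r ≡ nonMinStep r′ → r ≡ r′
nonMinStep-injective {0F} {0F} _  = refl
nonMinStep-injective {0F} {1F} ()
nonMinStep-injective {1F} {0F} ()
nonMinStep-injective {1F} {1F} _  = refl

stepFor-yes : ∀ r {A : Set} (a : A) → stepFor r (yes a) ≡ nonMinStep r
stepFor-yes 0F a = refl
stepFor-yes 1F a = refl

stepFor-no : ∀ r {A : Set} (¬a : ¬ A) → stepFor r (no ¬a) ≡ minStep r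
stepFor-no 0F ¬a = refl
stepFor-no 1F ¬a = refl

rowOf-stepFor : ∀ r {A : Set} (a? : Dec A) → rowOf (stepFor r a?) ≡ r
rowOf-stepFor 0F (yes _) = refl
rowOf-stepFor 0F (no _)  = refl
rowOf-stepFor 1F (yes _) = refl
rowOf-stepFor 1F (no _)  = refl

module _ (r : Fin 2) {A : Set} where

  stepFor≡minStep : ∀ {r′} (a? : Dec A) → stepFor r a? ≡ minStep r′ → r ≡ r′ × ¬ A
  stepFor≡minStep (yes a)  eq = contradiction (trans (sym (stepFor-yes r a)) eq) (nonMinStep≢minStep r _)
  stepFor≡minStep (no ¬a) eq = minStep-injective (trans (sym (stepFor-no r ¬a)) eq) , ¬a

  stepFor≡nonMinStep : ∀ {r′} (a? : Dec A) → stepFor r a? ≡ nonMinStep r′ → r ≡ r′ × A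
  stepFor≡nonMinStep (yes a)  eq = nonMinStep-injective (trans (sym (stepFor-yes r a)) eq) , a
  stepFor≡nonMinStep (no ¬a) eq = contradiction (trans (sym eq) (stepFor-no r ¬a)) (nonMinStep≢minStep _ r)

  stepFor≢minStep : (a? : Dec A) → stepFor r a? ≢ minStep r → A
  stepFor≢minStep (yes a)  _   = a
  stepFor≢minStep (no ¬a) neq = contradiction (stepFor-no r ¬a) neq

count< : ∀ {n} {P : Fin n → Set} → (∀ i → Dec (P i)) → ℕ → ℕ
count< P? zero = 0
count< {zero}  P? (suc m) = 0
count< {suc n} P? (suc m) with P? 0F
... | yes _ = suc (count< (P? ∘ Fin.suc) m)
... | no _  = count< (P? ∘ Fin.suc) m

count<-suc-yes : ∀ {n} {P : Fin n → Set} (P? : ∀ i → Dec (P i)) j → P j →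
                 count< P? (suc (toℕ j)) ≡ suc (count< P? (toℕ j))
count<-suc-yes P? 0F pj with P? 0F
... | yes _  = refl
... | no ¬p = contradiction pj ¬p
count<-suc-yes P? (Fin.suc j) pj with P? 0F
... | yes _ = cong suc (count<-suc-yes (P? ∘ Fin.suc) j pj)
... | no _  = count<-suc-yes (P? ∘ Fin.suc) j pj

count<-suc-no : ∀ {n} {P : Fin n → Set} (P? : ∀ i → Dec (P i)) j → ¬ P j →
                count< P? (suc (toℕ j)) ≡ count< P? (toℕ j)
count<-suc-no P? 0F ¬pj with P? 0F
... | yes p = contradiction p ¬pj
... | no _  = refl
count<-suc-no P? (Fin.suc j) ¬pj with P? 0F
... | yes _ = cong suc (count<-suc-no (P? ∘ Fin.suc) j ¬pj)
... | no _  = count<-suc-no (P? ∘ Fin.suc) j ¬pj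

count<-mono-≤ : ∀ {n} {P : Fin n → Set} (P? : ∀ i → Dec (P i)) {m m′} → m ≤ m′ →
                count< P? m ≤ count< P? m′
count<-mono-≤ P? {zero} _ = z≤n
count<-mono-≤ {zero}  P? {suc m} {suc m′} _ = z≤n
count<-mono-≤ {suc n} P? {suc m} {suc m′} (s≤s m≤m′) with P? 0F
... | yes _ = s≤s (count<-mono-≤ (P? ∘ Fin.suc) m≤m′)
... | no _  = count<-mono-≤ (P? ∘ Fin.suc) m≤m′

count<-cancel-< : ∀ {n} {P : Fin n → Set} (P? : ∀ i → Dec (P i)) {m m′} →
                  count< P? m < count< P? m′ → m < m′
count<-cancel-< P? lt = ≰⇒> λ m′≤m → <⇒≱ lt (count<-mono-≤ P? m′≤m)

count<-unfold-yes : ∀ {n} {P : Fin (suc n) → Set} (P? : ∀ i → Dec (P i)) {m} → P 0F →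
                    count< P? (suc m) ≡ suc (count< (P? ∘ Fin.suc) m)
count<-unfold-yes P? p0 with P? 0F
... | yes _  = refl
... | no ¬p = contradiction p0 ¬p

count<-unfold-no : ∀ {n} {P : Fin (suc n) → Set} (P? : ∀ i → Dec (P i)) {m} → ¬ P 0F →
                   count< P? (suc m) ≡ count< (P? ∘ Fin.suc) m
count<-unfold-no P? ¬p0 with P? 0F
... | yes p = contradiction p ¬p0
... | no _  = refl

count<-witness : ∀ {n} {P : Fin n → Set} (P? : ∀ i → Dec (P i)) {m} c → c < count< P? m →
                 ∃ λ i → toℕ i < m × P i × count< P? (toℕ i) ≡ c
count<-witness P? {zero} c ()
count<-witness {zero}  P? {suc m} c ()
count<-witness {suc n} P? {suc m} c lt with P? 0F
... | no ¬p with count<-witness (P? ∘ Fin.suc) c lt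
...   | i , i<m , pi , ci = Fin.suc i , s≤s i<m , pi , trans (count<-unfold-no P? ¬p) ci
count<-witness {suc n} P? {suc m} zero lt | yes p = 0F , s≤s z≤n , p , refl
count<-witness {suc n} P? {suc m} (suc c) lt | yes p with count<-witness (P? ∘ Fin.suc) c (s≤s⁻¹ lt)
...   | i , i<m , pi , ci = Fin.suc i , s≤s i<m , pi , trans (count<-unfold-yes P? p) (cong suc ci)

all<⇒≤ : ∀ {b x} → (∀ (c : Fin b) → toℕ c < x) → b ≤ x
all<⇒≤ {zero}  _   = z≤n
all<⇒≤ {suc b} all = subst (_< _) (toℕ-fromℕ b) (all (Fin.fromℕ b))

minsBefore : ∀ {n} → Fin 2 → (Fin n → Step) → ℕ → ℕ
minsBefore r g = count< (λ i → minStep? r (g i))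

module _ {n} (g : Fin n → Step) {r : Fin 2} where

  minsBefore-suc-minStep : ∀ j → g j ≡ minStep r → minsBefore r g (suc (toℕ j)) ≡ suc (minsBefore r g (toℕ j))
  minsBefore-suc-minStep = count<-suc-yes (λ i → minStep? r (g i))

  minsBefore-suc-other : ∀ j → g j ≢ minStep r → minsBefore r g (suc (toℕ j)) ≡ minsBefore r g (toℕ j)
  minsBefore-suc-other = count<-suc-no (λ i → minStep? r (g i))

  minsBefore-mono-≤ : ∀ {m m′} → m ≤ m′ → minsBefore r g m ≤ minsBefore r g m′
  minsBefore-mono-≤ = count<-mono-≤ (λ i → minStep? r (g i))

  minsBefore-cancel-< : ∀ {m m′} → minsBefore r g m < minsBefore r g m′ → m < m′
  minsBefore-cancel-< = count<-cancel-< (λ i → minStep? r (g i))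

  minsBefore-witness : ∀ {m} c → c < minsBefore r g m →
                       ∃ λ i → toℕ i < m × g i ≡ minStep r × minsBefore r g (toℕ i) ≡ c
  minsBefore-witness = count<-witness (λ i → minStep? r (g i))

ups downs : ∀ {n} → Path n → ℕ → ℕ
ups   p = minsBefore 0F (lookup p)
downs p = minsBefore 1F (lookup p)

motzFrom-U : ∀ h {n} {p : Path n} → MotzFrom h (U ∷ p) ≡ MotzFrom (suc h) p
motzFrom-U zero    = refl
motzFrom-U (suc h) = refl

motzFrom-H : ∀ h {c n} {p : Path n} → MotzFrom h (H c ∷ p) ≡ MotzFrom h p
motzFrom-H zero    = refl
motzFrom-H (suc h) = refl

RaisedAt : ∀ {n} → ℕ → Path n → Step → Set
RaisedAt h p s = ∀ j → lookup p j ≡ s → downs p (toℕ j) < h + ups p (toℕ j)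

module _ {s : Step} where

  raisedAt-∷U : ∀ {h n} {p : Path n} → RaisedAt h (U ∷ p) s → RaisedAt (suc h) p s
  raisedAt-∷U {h} {p = p} R j e = subst (downs p (toℕ j) <_) (+-suc h _) (R (Fin.suc j) e)

  raisedAt-∷D : ∀ {h n} {p : Path n} → RaisedAt (suc h) (D ∷ p) s → RaisedAt h p s
  raisedAt-∷D R j e = s≤s⁻¹ (R (Fin.suc j) e)

  raisedAt-∷H : ∀ {h c n} {p : Path n} → RaisedAt h (H c ∷ p) s → RaisedAt h p s
  raisedAt-∷H R j e = R (Fin.suc j) e

motzFrom⇒balanced : ∀ {n} h (p : Path n) → MotzFrom h p → h + ups p n ≡ downs p n
motzFrom⇒balanced zero    []      _ = refl
motzFrom⇒balanced (suc h) []      ()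
motzFrom⇒balanced h       (U ∷ p) m = trans (+-suc h _) (motzFrom⇒balanced (suc h) p (subst id (motzFrom-U h) m))
motzFrom⇒balanced zero    (D ∷ p) ()
motzFrom⇒balanced (suc h) (D ∷ p) m = cong suc (motzFrom⇒balanced h p m)
motzFrom⇒balanced h       (H c ∷ p) m = motzFrom⇒balanced h p (subst id (motzFrom-H h) m)

motzFrom⇒raisedAt-D : ∀ {n} h (p : Path n) → MotzFrom h p → RaisedAt h p D
motzFrom⇒raisedAt-D h       (U ∷ p)   m 0F ()
motzFrom⇒raisedAt-D h       (U ∷ p)   m (Fin.suc j) e =
  subst (downs p (toℕ j) <_) (sym (+-suc h _)) (motzFrom⇒raisedAt-D (suc h) p (subst id (motzFrom-U h) m) j e)
motzFrom⇒raisedAt-D zero    (D ∷ p)   ()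
motzFrom⇒raisedAt-D (suc h) (D ∷ p)   m 0F e = s≤s z≤n
motzFrom⇒raisedAt-D (suc h) (D ∷ p)   m (Fin.suc j) e = s≤s (motzFrom⇒raisedAt-D h p m j e)
motzFrom⇒raisedAt-D h       (H c ∷ p) m 0F ()
motzFrom⇒raisedAt-D h       (H c ∷ p) m (Fin.suc j) e = motzFrom⇒raisedAt-D h p (subst id (motzFrom-H h) m) j e

raisedAt-D⇒motzFrom : ∀ {n} h (p : Path n) → RaisedAt h p D → h + ups p n ≡ downs p n → MotzFrom h p
raisedAt-D⇒motzFrom zero    []      _ _  = tt
raisedAt-D⇒motzFrom (suc h) []      _ ()
raisedAt-D⇒motzFrom h       (U ∷ p) R eq =
  subst id (sym (motzFrom-U h)) (raisedAt-D⇒motzFrom (suc h) p (raisedAt-∷U R) (trans (sym (+-suc h _)) eq))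
raisedAt-D⇒motzFrom zero    (D ∷ p) R _  = contradiction (R 0F refl) λ ()
raisedAt-D⇒motzFrom (suc h) (D ∷ p) R eq = raisedAt-D⇒motzFrom h p (raisedAt-∷D R) (suc-injective eq)
raisedAt-D⇒motzFrom h       (H c ∷ p) R eq =
  subst id (sym (motzFrom-H h)) (raisedAt-D⇒motzFrom h p (raisedAt-∷H R) eq)

noUmber⇒raisedAt-umber : ∀ {n} h (p : Path n) → MotzFrom h p → NoUmberAtZeroFrom h p → RaisedAt h p (H umber)
noUmber⇒raisedAt-umber h       (U ∷ p)   m nu 0F ()
noUmber⇒raisedAt-umber h       (U ∷ p)   m nu (Fin.suc j) e =
  subst (downs p (toℕ j) <_) (sym (+-suc h _))
        (noUmber⇒raisedAt-umber (suc h) p (subst id (motzFrom-U h) m) nu j e)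
noUmber⇒raisedAt-umber zero    (D ∷ p)   ()
noUmber⇒raisedAt-umber (suc h) (D ∷ p)   m nu 0F ()
noUmber⇒raisedAt-umber (suc h) (D ∷ p)   m nu (Fin.suc j) e = s≤s (noUmber⇒raisedAt-umber h p m nu j e)
noUmber⇒raisedAt-umber zero    (H umber ∷ p) m ()
noUmber⇒raisedAt-umber (suc h) (H umber ∷ p) m nu 0F e = s≤s z≤n
noUmber⇒raisedAt-umber (suc h) (H umber ∷ p) m nu (Fin.suc j) e = noUmber⇒raisedAt-umber (suc h) p m nu j e
noUmber⇒raisedAt-umber h       (H denim ∷ p) m nu 0F ()
noUmber⇒raisedAt-umber zero    (H denim ∷ p) m nu (Fin.suc j) e = noUmber⇒raisedAt-umber zero p m nu j e
noUmber⇒raisedAt-umber (suc h) (H denim ∷ p) m nu (Fin.suc j) e = noUmber⇒raisedAt-umber (suc h) p m nu j e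

raisedAt⇒noUmber : ∀ {n} h (p : Path n) → RaisedAt h p D → RaisedAt h p (H umber) → NoUmberAtZeroFrom h p
raisedAt⇒noUmber h       []            _  _  = tt
raisedAt⇒noUmber h       (U ∷ p)       RD RU = raisedAt⇒noUmber (suc h) p (raisedAt-∷U RD) (raisedAt-∷U RU)
raisedAt⇒noUmber zero    (D ∷ p)       RD _  = contradiction (RD 0F refl) λ ()
raisedAt⇒noUmber (suc h) (D ∷ p)       RD RU = raisedAt⇒noUmber h p (raisedAt-∷D RD) (raisedAt-∷D RU)
raisedAt⇒noUmber zero    (H umber ∷ p) _  RU = contradiction (RU 0F refl) λ ()
raisedAt⇒noUmber (suc h) (H umber ∷ p) RD RU = raisedAt⇒noUmber (suc h) p (raisedAt-∷H RD) (raisedAt-∷H RU)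
raisedAt⇒noUmber zero    (H denim ∷ p) RD RU = raisedAt⇒noUmber zero p (raisedAt-∷H RD) (raisedAt-∷H RU)
raisedAt⇒noUmber (suc h) (H denim ∷ p) RD RU = raisedAt⇒noUmber (suc h) p (raisedAt-∷H RD) (raisedAt-∷H RU)

DownBeforeDenim : ∀ {n} → Path n → Set
DownBeforeDenim p = ∀ j → lookup p j ≡ H denim → 0 < downs p (toℕ j)

noDenim⇒downBeforeDenim : ∀ {n} (p : Path n) → NoDenimBeforeFirstD p → DownBeforeDenim p
noDenim⇒downBeforeDenim (U ∷ p)       nd 0F ()
noDenim⇒downBeforeDenim (U ∷ p)       nd (Fin.suc j) e = noDenim⇒downBeforeDenim p nd j e
noDenim⇒downBeforeDenim (D ∷ p)       _  0F ()
noDenim⇒downBeforeDenim (D ∷ p)       _  (Fin.suc j) _ = s≤s z≤n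
noDenim⇒downBeforeDenim (H umber ∷ p) nd 0F ()
noDenim⇒downBeforeDenim (H umber ∷ p) nd (Fin.suc j) e = noDenim⇒downBeforeDenim p nd j e
noDenim⇒downBeforeDenim (H denim ∷ p) ()

downBeforeDenim⇒noDenim : ∀ {n} (p : Path n) → DownBeforeDenim p → NoDenimBeforeFirstD p
downBeforeDenim⇒noDenim []            _ = tt
downBeforeDenim⇒noDenim (U ∷ p)       B = downBeforeDenim⇒noDenim p (B ∘ Fin.suc)
downBeforeDenim⇒noDenim (D ∷ p)       _ = tt
downBeforeDenim⇒noDenim (H umber ∷ p) B = downBeforeDenim⇒noDenim p (B ∘ Fin.suc)
downBeforeDenim⇒noDenim (H denim ∷ p) B = contradiction (B 0F refl) λ ()

motzFrom⇒downs≤ups : ∀ {n} h (p : Path n) → MotzFrom h p → ∀ m → downs p m ≤ h + ups p m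
motzFrom⇒downs≤ups h p         _ zero = z≤n
motzFrom⇒downs≤ups h []        _ (suc m) = z≤n
motzFrom⇒downs≤ups h (U ∷ p)   mz (suc m) =
  subst (downs p m ≤_) (sym (+-suc h _)) (motzFrom⇒downs≤ups (suc h) p (subst id (motzFrom-U h) mz) m)
motzFrom⇒downs≤ups zero    (D ∷ p) () (suc m)
motzFrom⇒downs≤ups (suc h) (D ∷ p) mz (suc m) = s≤s (motzFrom⇒downs≤ups h p mz m)
motzFrom⇒downs≤ups h (H c ∷ p) mz (suc m) = motzFrom⇒downs≤ups h p (subst id (motzFrom-H h) mz) m

horizontals+ups+downs : ∀ {n} (p : Path n) → horizontals p + (ups p n + downs p n) ≡ n
horizontals+ups+downs []        = refl
horizontals+ups+downs (U ∷ p)   = trans (+-suc (horizontals p) _) (cong suc (horizontals+ups+downs p))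
horizontals+ups+downs {suc n} (D ∷ p) = begin
  horizontals p + (ups p n + suc (downs p n)) ≡⟨ cong (horizontals p +_) (+-suc (ups p n) _) ⟩
  horizontals p + suc (ups p n + downs p n)   ≡⟨ +-suc (horizontals p) _ ⟩
  suc (horizontals p + (ups p n + downs p n)) ≡⟨ cong suc (horizontals+ups+downs p) ⟩
  suc n                                       ∎
  where open ≡-Reasoning
horizontals+ups+downs (H c ∷ p) = cong suc (horizontals+ups+downs p)

record Motz12Counts {n} (p : Path n) : Set where
  field
    balanced          : ups p n ≡ downs p n
    raisedAt-D        : RaisedAt 0 p D
    raisedAt-umber    : RaisedAt 0 p (H umber)
    downBeforeDenim   : DownBeforeDenim p

motz12⇒counts : ∀ {n} {p : Path n} → IsMotz12 p → Motz12Counts p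
motz12⇒counts {p = p} (mz , nu , nd) = record
  { balanced        = motzFrom⇒balanced 0 p mz
  ; raisedAt-D      = motzFrom⇒raisedAt-D 0 p mz
  ; raisedAt-umber  = noUmber⇒raisedAt-umber 0 p mz nu
  ; downBeforeDenim = noDenim⇒downBeforeDenim p nd
  }

counts⇒motz12 : ∀ {n} {p : Path n} → Motz12Counts p → IsMotz12 p
counts⇒motz12 {p = p} c =
    raisedAt-D⇒motzFrom 0 p raisedAt-D balanced
  , raisedAt⇒noUmber 0 p raisedAt-D raisedAt-umber
  , downBeforeDenim⇒noDenim p downBeforeDenim
  where open Motz12Counts c

module _ (b k : ℕ) (p : Path (2 * b + k)) where
  private
    n = 2 * b + k

  mins-total⇒horizontals≡k : ups p n ≡ b → downs p n ≡ b → horizontals p ≡ k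
  mins-total⇒horizontals≡k ups≡b downs≡b = +-cancelʳ-≡ (2 * b) (horizontals p) k (begin
    horizontals p + 2 * b                 ≡⟨ cong₂ (λ u d → horizontals p + (u + d)) (sym ups≡b)
                                                   (trans (+-identityʳ b) (sym downs≡b)) ⟩
    horizontals p + (ups p n + downs p n) ≡⟨ horizontals+ups+downs p ⟩
    2 * b + k                             ≡⟨ +-comm (2 * b) k ⟩
    k + 2 * b                             ∎)
    where open ≡-Reasoning

  horizontals≡k⇒ups≡b : ups p n ≡ downs p n → horizontals p ≡ k → ups p n ≡ b
  horizontals≡k⇒ups≡b balanced hk = *-cancelˡ-≡ (ups p n) b 2 (+-cancelˡ-≡ k _ _ (begin
    k + 2 * ups p n                       ≡⟨ cong₂ (λ h d → h + (ups p n + d)) (sym hk)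
                                                   (trans (+-identityʳ _) balanced) ⟩
    horizontals p + (ups p n + downs p n) ≡⟨ horizontals+ups+downs p ⟩
    2 * b + k                             ≡⟨ +-comm (2 * b) k ⟩
    k + 2 * b                             ∎))
    where open ≡-Reasoning

module Tableau {b k : ℕ} (f : Filling b k) (isf : IsSYT+ b k f) where
  open IsSYT+ isf

  private
    n = 2 * b + k

  g : Entries b k → Step
  g = lookup (β f)

  mins : Fin 2 → ℕ → ℕ
  mins r = minsBefore r g

  Earlier : Entries b k → Set
  Earlier j = ∃ λ i → i Fin.< j × f i ≡ f j

  g-stepFor : ∀ j → g j ≡ stepFor (row (f j)) (earlier? f j)
  g-stepFor = lookup∘tabulate _

  rowOf-g : ∀ j → rowOf (g j) ≡ row (f j)
  rowOf-g j = trans (cong rowOf (g-stepFor j)) (rowOf-stepFor (row (f j)) (earlier? f j))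

  g≡minStep : ∀ {r} j → g j ≡ minStep r → f j ≡ (r , col (f j)) × ¬ Earlier j
  g≡minStep j e with stepFor≡minStep (row (f j)) (earlier? f j) (trans (sym (g-stepFor j)) e)
  ... | row≡r , ¬earlier = cong (_, col (f j)) row≡r , ¬earlier

  g≡nonMinStep : ∀ {r} j → g j ≡ nonMinStep r → f j ≡ (r , col (f j)) × Earlier j
  g≡nonMinStep j e with stepFor≡nonMinStep (row (f j)) (earlier? f j) (trans (sym (g-stepFor j)) e)
  ... | row≡r , earlier = cong (_, col (f j)) row≡r , earlier

  g≢minStep : ∀ {r c} j → g j ≢ minStep r → f j ≡ (r , c) → Earlier j
  g≢minStep j ne refl = stepFor≢minStep (row (f j)) (earlier? f j) (ne ∘ trans (g-stepFor j))

  row-increasing : ∀ {r c c′ i j} → toℕ c < toℕ c′ → f i ≡ (r , c) → f j ≡ (r , c′) → i Fin.< j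
  row-increasing c<c′ = increasing _ _ (λ eq → <-irrefl (cong (toℕ ∘ col) eq) c<c′) (≤-refl , <⇒≤ c<c′) _ _

  column-increasing : ∀ {c c′ i j} → toℕ c ≤ toℕ c′ → f i ≡ (0F , c) → f j ≡ (1F , c′) → i Fin.< j
  column-increasing c≤c′ = increasing _ _ (λ ()) (z≤n , c≤c′) _ _

  Opened : Fin 2 → Fin b → ℕ → Set
  Opened r c m = ∃ λ i → toℕ i < m × f i ≡ (r , c)

  Opened-weaken : ∀ {r c m} → Opened r c m → Opened r c (suc m)
  Opened-weaken (i , i<m , fi) = i , m<n⇒m<1+n i<m , fi

  Opened-suc : ∀ {r c} j → Opened r c (suc (toℕ j)) → Opened r c (toℕ j) ⊎ f j ≡ (r , c)
  Opened-suc j (i , i<1+j , fi) with m<1+n⇒m<n∨m≡n i<1+j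
  ... | inj₁ i<j = inj₁ (i , i<j , fi)
  ... | inj₂ i≡j = inj₂ (subst (λ x → f x ≡ _) (toℕ-injective i≡j) fi)

  record MinsCountOpened (r : Fin 2) (m : ℕ) : Set where
    field
      bounded : mins r m ≤ b
      opened  : ∀ c → toℕ c < mins r m → Opened r c m
      counted : ∀ c → Opened r c m → toℕ c < mins r m

  col≡minsBefore : ∀ {r} j → MinsCountOpened r (toℕ j) → g j ≡ minStep r → toℕ (col (f j)) ≡ mins r (toℕ j)
  col≡minsBefore {r} j inv e = ≤-antisym (≮⇒≥ mins≮col) (≮⇒≥ col≮mins)
    where
      open MinsCountOpened inv
      fj = proj₁ (g≡minStep j e)

      col≮mins : ¬ toℕ (col (f j)) < mins r (toℕ j)
      col≮mins lt with opened _ lt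
      ... | i , i<j , fi = proj₂ (g≡minStep j e) (i , i<j , trans fi (sym fj))

      mins≮col : ¬ mins r (toℕ j) < toℕ (col (f j))
      mins≮col lt =
        let c<b = <-trans lt (toℕ<n (col (f j)))
            c = fromℕ< c<b
            (i , fi) = nonempty (r , c)
            i<j = row-increasing (subst (_< _) (sym (toℕ-fromℕ< c<b)) lt) fi fj
        in <-irrefl (toℕ-fromℕ< c<b) (counted c (i , i<j , fi))

  minsCountOpened-suc-minStep : ∀ {r} j → MinsCountOpened r (toℕ j) → g j ≡ minStep r →
                                MinsCountOpened r (suc (toℕ j))
  minsCountOpened-suc-minStep {r} j inv e = record
    { bounded = subst (_≤ b) (trans (cong suc col≡mins) (sym mins-suc)) (toℕ<n (col (f j)))
    ; opened  = opened′
    ; counted = counted′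
    }
    where
      open MinsCountOpened inv
      fj = proj₁ (g≡minStep j e)
      col≡mins = col≡minsBefore j inv e
      mins-suc = minsBefore-suc-minStep g j e

      opened′ : ∀ c → toℕ c < mins r (suc (toℕ j)) → Opened r c (suc (toℕ j))
      opened′ c lt with m<1+n⇒m<n∨m≡n (subst (toℕ c <_) mins-suc lt)
      ... | inj₁ c<mins = Opened-weaken (opened c c<mins)
      ... | inj₂ c≡mins = j , n<1+n _ , trans fj (cong (r ,_) (toℕ-injective (trans col≡mins (sym c≡mins))))

      counted′ : ∀ c → Opened r c (suc (toℕ j)) → toℕ c < mins r (suc (toℕ j))
      counted′ c op with Opened-suc j op
      ... | inj₁ op′ = subst (toℕ c <_) (sym mins-suc) (m<n⇒m<1+n (counted c op′))
      ... | inj₂ fj′ = subst (toℕ c <_) (sym mins-suc)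
                         (s≤s (≤-reflexive (trans (cong (toℕ ∘ proj₂) (trans (sym fj′) fj)) col≡mins)))

  minsCountOpened-suc-other : ∀ {r} j → MinsCountOpened r (toℕ j) → g j ≢ minStep r →
                              MinsCountOpened r (suc (toℕ j))
  minsCountOpened-suc-other {r} j inv ne = record
    { bounded = subst (_≤ b) (sym mins-suc) bounded
    ; opened  = λ c lt → Opened-weaken (opened c (subst (toℕ c <_) mins-suc lt))
    ; counted = counted′
    }
    where
      open MinsCountOpened inv
      mins-suc = minsBefore-suc-other g j ne

      counted′ : ∀ c → Opened r c (suc (toℕ j)) → toℕ c < mins r (suc (toℕ j))
      counted′ c op with Opened-suc j op
      ... | inj₁ op′ = subst (toℕ c <_) (sym mins-suc) (counted c op′)
      ... | inj₂ fj with g≢minStep j ne fj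
      ...   | i , i<j , fi≡fj = subst (toℕ c <_) (sym mins-suc) (counted c (i , i<j , trans fi≡fj fj))

  minsCountOpened-suc : ∀ r j → MinsCountOpened r (toℕ j) → MinsCountOpened r (suc (toℕ j))
  minsCountOpened-suc r j inv with minStep? r (g j)
  ... | yes e  = minsCountOpened-suc-minStep j inv e
  ... | no ne = minsCountOpened-suc-other j inv ne

  minsCountOpened : ∀ r m → m ≤ n → MinsCountOpened r m
  minsCountOpened r zero    _   = record { bounded = z≤n ; opened = λ _ () ; counted = λ { _ (_ , () , _) } }
  minsCountOpened r (suc m) m<n = subst (MinsCountOpened r ∘ suc) j≡m
    (minsCountOpened-suc r (fromℕ< m<n) (subst (MinsCountOpened r) (sym j≡m) (minsCountOpened r m (<⇒≤ m<n))))
    where j≡m = toℕ-fromℕ< m<n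

  minsCountOpened-at : ∀ r (j : Entries b k) → MinsCountOpened r (toℕ j)
  minsCountOpened-at r j = minsCountOpened r (toℕ j) (<⇒≤ (toℕ<n j))

  mins-total : ∀ r → mins r n ≡ b
  mins-total r = ≤-antisym bounded (all<⇒≤ λ c → let (i , fi) = nonempty (r , c) in counted c (i , toℕ<n i , fi))
    where open MinsCountOpened (minsCountOpened r n ≤-refl)

  mins-col : ∀ j → mins (row (f j)) (suc (toℕ j)) ≡ suc (toℕ (col (f j)))
  mins-col j = ≤-antisym (≮⇒≥ col+1≮mins) (counted (col (f j)) (j , ≤-refl , refl))
    where
      open MinsCountOpened (minsCountOpened (row (f j)) (suc (toℕ j)) (toℕ<n j))

      col+1≮mins : ¬ suc (toℕ (col (f j))) < mins (row (f j)) (suc (toℕ j))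
      col+1≮mins lt =
        let c<b = <-≤-trans lt bounded
            c≡col+1 = toℕ-fromℕ< c<b
            (i , i<1+j , fi) = opened (fromℕ< c<b) (subst (_< mins (row (f j)) (suc (toℕ j))) (sym c≡col+1) lt)
            j<i = row-increasing (subst (toℕ (col (f j)) <_) (sym c≡col+1) (n<1+n _)) refl fi
        in <⇒≱ j<i (s≤s⁻¹ i<1+j)

  motz12Counts : Motz12Counts (β f)
  motz12Counts = record
    { balanced        = trans (mins-total 0F) (sym (mins-total 1F))
    ; raisedAt-D      = raisedAt-D
    ; raisedAt-umber  = raisedAt-umber
    ; downBeforeDenim = downBeforeDenim
    }
    where
      module Top j    = MinsCountOpened (minsCountOpened-at 0F j)
      module Bottom j = MinsCountOpened (minsCountOpened-at 1F j)

      raisedAt-D : RaisedAt 0 (β f) D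
      raisedAt-D j e =
        let (i , fi) = nonempty (0F , col (f j))
            i<j = column-increasing ≤-refl fi (proj₁ (g≡minStep j e))
        in subst (_< mins 0F (toℕ j)) (col≡minsBefore j (minsCountOpened-at 1F j) e)
                 (Top.counted j _ (i , i<j , fi))

      raisedAt-umber : RaisedAt 0 (β f) (H umber)
      raisedAt-umber j e =
        let (fj , i , i<j , fi≡fj) = g≡nonMinStep j e
            below-col = λ lt → let (i′ , i′<j , fi′) = Bottom.opened j _ lt
                               in <-asym i′<j (column-increasing ≤-refl fj fi′)
        in ≤-<-trans (≮⇒≥ below-col) (Top.counted j _ (i , i<j , trans fi≡fj fj))

      downBeforeDenim : DownBeforeDenim (β f)
      downBeforeDenim j e =
        let (fj , i , i<j , fi≡fj) = g≡nonMinStep j e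
        in ≤-<-trans z≤n (Bottom.counted j _ (i , i<j , trans fi≡fj fj))

β-injective : ∀ {b k} {f f′ : Filling b k} → IsSYT+ b k f → IsSYT+ b k f′ → β f ≡ β f′ → ∀ j → f j ≡ f′ j
β-injective {f = f} {f′} isf isf′ eq j = cong₂ _,_ rows (toℕ-injective (suc-injective cols))
  where
    module T  = Tableau f isf
    module T′ = Tableau f′ isf′
    open ≡-Reasoning

    rows : row (f j) ≡ row (f′ j)
    rows = trans (sym (T.rowOf-g j)) (trans (cong (λ p → rowOf (lookup p j)) eq) (T′.rowOf-g j))

    cols : suc (toℕ (col (f j))) ≡ suc (toℕ (col (f′ j)))
    cols = begin
      suc (toℕ (col (f j)))                                 ≡⟨ T.mins-col j ⟨
      minsBefore (row (f j)) (lookup (β f)) (suc (toℕ j))   ≡⟨ cong₂ (λ r p → minsBefore r (lookup p) (suc (toℕ j))) rows eq ⟩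
      minsBefore (row (f′ j)) (lookup (β f′)) (suc (toℕ j)) ≡⟨ T′.mins-col j ⟩
      suc (toℕ (col (f′ j)))                                ∎

module FromPath {b k : ℕ} (p : Path (2 * b + k)) (motz : IsMotz12 p) (hk : horizontals p ≡ k) where
  open Motz12Counts (motz12⇒counts {p = p} motz)

  private
    n = 2 * b + k

  g : Entries b k → Step
  g = lookup p

  mins : Fin 2 → ℕ → ℕ
  mins r = minsBefore r g

  mins-total : ∀ r → mins r n ≡ b
  mins-total 0F = horizontals≡k⇒ups≡b b k p balanced hk
  mins-total 1F = trans (sym balanced) (horizontals≡k⇒ups≡b b k p balanced hk)

  mins-pos-before-nonMinStep : ∀ {r} j → g j ≡ nonMinStep r → 0 < mins r (toℕ j)
  mins-pos-before-nonMinStep {0F} j e = ≤-<-trans z≤n (raisedAt-umber j e)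
  mins-pos-before-nonMinStep {1F} j e = downBeforeDenim j e

  raised-after-top : ∀ i → rowOf (g i) ≡ 0F → mins 1F (suc (toℕ i)) < mins 0F (suc (toℕ i))
  raised-after-top i row≡ with g i in e
  ... | U = begin-strict
    mins 1F (suc (toℕ i)) ≡⟨ minsBefore-suc-other g i ((λ ()) ∘ trans (sym e)) ⟩
    mins 1F (toℕ i)       ≤⟨ motzFrom⇒downs≤ups 0 p (proj₁ motz) (toℕ i) ⟩
    mins 0F (toℕ i)       <⟨ n<1+n _ ⟩
    suc (mins 0F (toℕ i)) ≡⟨ minsBefore-suc-minStep g i e ⟨
    mins 0F (suc (toℕ i)) ∎
    where open ≤-Reasoning
  ... | H umber = begin-strict
    mins 1F (suc (toℕ i)) ≡⟨ minsBefore-suc-other g i ((λ ()) ∘ trans (sym e)) ⟩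
    mins 1F (toℕ i)       <⟨ raisedAt-umber i e ⟩
    mins 0F (toℕ i)       ≡⟨ minsBefore-suc-other g i ((λ ()) ∘ trans (sym e)) ⟨
    mins 0F (suc (toℕ i)) ∎
    where open ≤-Reasoning

  rank : Entries b k → ℕ
  rank j = mins (rowOf (g j)) (suc (toℕ j))

  rank-pos : ∀ j → 0 < rank j
  rank-pos j with step-view (g j)
  ... | inj₁ e = subst (0 <_) (sym (minsBefore-suc-minStep g j e)) z<s
  ... | inj₂ e = subst (0 <_) (sym (minsBefore-suc-other g j (nonMinStep≢minStep _ _ ∘ trans (sym e))))
                       (mins-pos-before-nonMinStep j e)

  suc-pred-rank : ∀ j → suc (pred (rank j)) ≡ rank j
  suc-pred-rank j = suc-pred (rank j) {{>-nonZero (rank-pos j)}}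

  rank≤b : ∀ j → rank j ≤ b
  rank≤b j = subst (rank j ≤_) (mins-total _) (minsBefore-mono-≤ g (toℕ<n j))

  φ : Filling b k
  φ j = rowOf (g j) , fromℕ< (subst (_≤ b) (sym (suc-pred-rank j)) (rank≤b j))

  rank-φ : ∀ j → suc (toℕ (col (φ j))) ≡ rank j
  rank-φ j = trans (cong suc (toℕ-fromℕ< _)) (suc-pred-rank j)

  φ≡ : ∀ {r c} j → rowOf (g j) ≡ r → mins r (suc (toℕ j)) ≡ suc (toℕ c) → φ j ≡ (r , c)
  φ≡ j refl rank≡ = cong (_ ,_) (toℕ-injective (suc-injective (trans (rank-φ j) rank≡)))

  φ≡⇒ : ∀ {r c} j → φ j ≡ (r , c) → mins r (suc (toℕ j)) ≡ suc (toℕ c)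
  φ≡⇒ j refl = sym (rank-φ j)

  φ-nonempty : ∀ c → ∃ λ j → φ j ≡ c
  φ-nonempty (r , c) =
    let c<mins = subst (toℕ c <_) (sym (mins-total r)) (toℕ<n c)
        (j , _ , e , mins≡c) = minsBefore-witness g {m = n} (toℕ c) c<mins
    in j , φ≡ j (trans (cong rowOf e) (rowOf-minStep r)) (trans (minsBefore-suc-minStep g j e) (cong suc mins≡c))

  φ-row-increasing : ∀ {r cu cv} i j → toℕ cu < toℕ cv → φ i ≡ (r , cu) → φ j ≡ (r , cv) → i Fin.< j
  φ-row-increasing i j cu<cv φi φj =
    s≤s⁻¹ (minsBefore-cancel-< g (subst₂ _<_ (sym (φ≡⇒ i φi)) (sym (φ≡⇒ j φj)) (s≤s cu<cv)))

  φ-column-increasing : ∀ {cu cv} i j → toℕ cu ≤ toℕ cv → φ i ≡ (0F , cu) → φ j ≡ (1F , cv) → i Fin.< j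
  φ-column-increasing {cu} {cv} i j cu≤cv φi φj = ≰⇒> λ j≤i → <⇒≱ (raised-after-top i (cong proj₁ φi)) (begin
    mins 0F (suc (toℕ i)) ≡⟨ φ≡⇒ i φi ⟩
    suc (toℕ cu)          ≤⟨ s≤s cu≤cv ⟩
    suc (toℕ cv)          ≡⟨ φ≡⇒ j φj ⟨
    mins 1F (suc (toℕ j)) ≤⟨ minsBefore-mono-≤ g (s≤s j≤i) ⟩
    mins 1F (suc (toℕ i)) ∎)
    where open ≤-Reasoning

  φ-increasing : ∀ u v → u ≢ v → WeaklyNW u v → ∀ i j → φ i ≡ u → φ j ≡ v → i Fin.< j
  φ-increasing (0F , cu) (0F , cv) u≢v (_ , cu≤cv) i j =
    φ-row-increasing i j (≤∧≢⇒< cu≤cv (u≢v ∘ cong (0F ,_) ∘ toℕ-injective))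
  φ-increasing (1F , cu) (1F , cv) u≢v (_ , cu≤cv) i j =
    φ-row-increasing i j (≤∧≢⇒< cu≤cv (u≢v ∘ cong (1F ,_) ∘ toℕ-injective))
  φ-increasing (0F , cu) (1F , cv) _   (_ , cu≤cv) i j = φ-column-increasing i j cu≤cv
  φ-increasing (1F , cu) (0F , cv) _   (() , _)

  φ-isSYT+ : IsSYT+ b k φ
  φ-isSYT+ = record { nonempty = φ-nonempty ; increasing = φ-increasing }

  minStep-not-earlier : ∀ j → g j ≡ minStep (rowOf (g j)) → ¬ (∃ λ i → i Fin.< j × φ i ≡ φ j)
  minStep-not-earlier j e (i , i<j , φi≡φj) = <-irrefl refl (begin-strict
    mins r (toℕ j)        <⟨ n<1+n _ ⟩
    suc (mins r (toℕ j))  ≡⟨ minsBefore-suc-minStep g j e ⟨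
    rank j                ≡⟨ rank-φ j ⟨
    suc (toℕ (col (φ j))) ≡⟨ φ≡⇒ i φi≡φj ⟨
    mins r (suc (toℕ i))  ≤⟨ minsBefore-mono-≤ g i<j ⟩
    mins r (toℕ j)        ∎)
    where
      r = rowOf (g j)
      open ≤-Reasoning

  nonMinStep-earlier : ∀ j → g j ≡ nonMinStep (rowOf (g j)) → ∃ λ i → i Fin.< j × φ i ≡ φ j
  nonMinStep-earlier j e =
    let (i , i<j , ei , mins≡) = minsBefore-witness g (pred (mins r (toℕ j))) pred<mins
    in i , i<j , φ≡ i (trans (cong rowOf ei) (rowOf-minStep r)) (begin
      mins r (suc (toℕ i))        ≡⟨ minsBefore-suc-minStep g i ei ⟩
      suc (mins r (toℕ i))        ≡⟨ cong suc mins≡ ⟩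
      suc (pred (mins r (toℕ j))) ≡⟨ suc-pred _ {{>-nonZero pos}} ⟩
      mins r (toℕ j)              ≡⟨ minsBefore-suc-other g j (nonMinStep≢minStep _ _ ∘ trans (sym e)) ⟨
      rank j                      ≡⟨ rank-φ j ⟨
      suc (toℕ (col (φ j)))       ∎)
    where
      r = rowOf (g j)
      pos = mins-pos-before-nonMinStep j e
      pred<mins = subst (pred (mins r (toℕ j)) <_) (suc-pred _ {{>-nonZero pos}}) (n<1+n _)
      open ≡-Reasoning

  stepFor-φ : ∀ j → stepFor (rowOf (g j)) (earlier? φ j) ≡ g j
  stepFor-φ j with earlier? φ j | step-view (g j)
  ... | yes ea  | inj₁ e = contradiction ea (minStep-not-earlier j e)
  ... | yes ea  | inj₂ e = trans (stepFor-yes _ ea) (sym e)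
  ... | no ¬ea | inj₁ e = trans (stepFor-no _ ¬ea) (sym e)
  ... | no ¬ea | inj₂ e = contradiction (nonMinStep-earlier j e) ¬ea

  β-φ : β φ ≡ p
  β-φ = trans (tabulate-cong stepFor-φ) (tabulate∘lookup p)

theorem11 : (b k : ℕ) → 1 ≤ b →
    ((S : SYT+ b k) → IsMotz12 (β (proj₁ S)) × horizontals (β (proj₁ S)) ≡ k)
    × ((S S′ : SYT+ b k) → β (proj₁ S) ≡ β (proj₁ S′) → (j : Entries b k) → proj₁ S j ≡ proj₁ S′ j)
    × ((p : Path (2 * b + k)) → IsMotz12 p → horizontals p ≡ k → ∃ λ (S : SYT+ b k) → β (proj₁ S) ≡ p)
theorem11 b k _ = sound , injective , surjective
  where
    sound : (S : SYT+ b k) → IsMotz12 (β (proj₁ S)) × horizontals (β (proj₁ S)) ≡ k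
    sound (f , isf) = counts⇒motz12 motz12Counts , mins-total⇒horizontals≡k b k (β f) (mins-total 0F) (mins-total 1F)
      where open Tableau f isf

    injective : (S S′ : SYT+ b k) → β (proj₁ S) ≡ β (proj₁ S′) → ∀ j → proj₁ S j ≡ proj₁ S′ j
    injective (_ , isf) (_ , isf′) = β-injective isf isf′

    surjective : (p : Path (2 * b + k)) → IsMotz12 p → horizontals p ≡ k → ∃ λ (S : SYT+ b k) → β (proj₁ S) ≡ p
    surjective p motz hk = (φ , φ-isSYT+) , β-φ
      where open FromPath {b} {k} p motz hk
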